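{- Let $G$ be a finite connected graph with circumference $c(G)=3$ and radius $r$. Then the diameter of $G$ belongs to $\{2r-1,\,2r\}$.
   Context: Graphs are finite, simple and undirected. For a connected graph $G$, $d(u,v)$ is the length of a shortest $u$–$v$ path. The eccentricity of a vertex $u$ is $e(u)=\max\{d(u,v): v\in V(G)\}$. The radius of $G$ is the minimum eccentricity over all vertices. The diameter of $G$ is the maximum eccentricity over all vertices. The circumference $c(G)$ is the length of a longest cycle in $G$. -}

module Defs where

open import Data.Nat using (ℕ; zero; suc; _≤_; _≥_)
open import Data.Fin using (Fin; toℕ)
open import Data.Bool using (Bool; true; false)
open import Data.Product using (Σ; ∃; _×_)
open import Function.Definitions using (Injective)
open import Relation.Binary.PropositionalEquality using (_≡_)

record Graph (n : ℕ) : Set where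
  field
    adj    : Fin n → Fin n → Bool
    sym    : ∀ u v → adj u v ≡ adj v u
    irrefl : ∀ u → adj u u ≡ false

module _ {n : ℕ} (G : Graph n) where
  open Graph G

  Adj : Fin n → Fin n → Set
  Adj u v = adj u v ≡ true

  data Walk : Fin n → Fin n → ℕ → Set where
    here : ∀ {u} → Walk u u zero
    step : ∀ {u w v k} → Adj u w → Walk w v k → Walk u v (suc k)

  Connected : Set
  Connected = ∀ u v → ∃ λ k → Walk u v k

  Dist : Fin n → Fin n → ℕ → Set
  Dist u v d = Walk u v d × (∀ k → Walk u v k → d ≤ k)

  Ecc : Fin n → ℕ → Set
  Ecc u e = (∀ v d → Dist u v d → d ≤ e) × (∃ λ v → Dist u v e)

  Radius : ℕ → Set
  Radius r = (∃ λ u → Ecc u r) × (∀ u e → Ecc u e → r ≤ e)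

  Diameter : ℕ → Set
  Diameter D = (∃ λ u → Ecc u D) × (∀ u e → Ecc u e → e ≤ D)

  HasCycle : ℕ → Set
  HasCycle k = k ≥ 3 × Σ (Fin k → Fin n) λ f →
      Injective _≡_ _≡_ f
    × (∀ i j → suc (toℕ i) ≡ toℕ j → Adj (f i) (f j))
    × (∀ i j → toℕ i ≡ zero → suc (toℕ j) ≡ k → Adj (f j) (f i))

  Circumference : ℕ → Set
  Circumference c = HasCycle c × (∀ k → HasCycle k → k ≤ c)

-- Let x, y be a diametral pair and write D = d(x, y) = (i + 1) + (j + 1) with i ≤ j ≤ i + 1.
-- Let c be the vertex at distance i + 1 from x on a shortest x–y path, and p, p' its neighbours
-- on that path towards x and y; p and p' are distinct and non-adjacent. If some v had
-- d(c, v) ≥ j + 2, shortest paths from x and from y to v could not pass through c without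
-- exceeding D, so p and p' would be joined in G − c; with c this closes a cycle of length ≥ 4.
-- Hence e(c) ≤ j + 1 and 2r ≤ D + 1, while D ≤ 2r holds in every connected graph by the
-- triangle inequality through a centre.
module Submission where

open import Defs
open import Data.Nat using (ℕ; zero; suc; _+_; _*_; _≤_; _<_; z≤n; s≤s; _≤?_)
open import Data.Nat.Properties hiding (_≟_)
open import Data.Fin using (Fin; zero; suc; toℕ; _≟_)
open import Data.Fin.Properties using (any?)
open import Data.Bool using (true)
import Data.Bool.Properties as Bool
open import Data.Product using (Σ; ∃; ∃₂; _×_; _,_; proj₁; proj₂)
open import Data.Sum using (_⊎_; inj₁; inj₂)
open import Data.Empty using (⊥-elim)
open import Function using (_∘_)
open import Level using (Level)
open import Relation.Nullary using (¬_; Dec; yes; no)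
open import Relation.Nullary.Decidable using (map′; _×-dec_)
open import Relation.Binary.Core using (Rel)
open import Relation.Binary.PropositionalEquality
open import Data.List using (List; []; _∷_; length; lookup; allFin)
open import Data.List.Relation.Unary.Any using (here; there)
open import Data.List.Relation.Unary.All using (All; []; _∷_)
import Data.List.Relation.Unary.All as All
open import Data.List.Relation.Unary.All.Properties using (¬Any⇒All¬)
open import Data.List.Relation.Unary.AllPairs using ([]; _∷_)
open import Data.List.Relation.Unary.Linked using (Linked; [-]; _∷_)
open import Data.List.Relation.Unary.Unique.Propositional using (Unique)
open import Data.List.Membership.Propositional using (_∈_)
open import Data.List.Membership.Propositional.Properties using (∈-lookup; ∈-allFin)
import Data.List.Membership.DecPropositional as DecMembership
open import Data.List.Extrema.Nat using (argmax; f[xs]≤f[argmax])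

least-witness : {P : ℕ → Set} → (∀ k → Dec (P k)) → ∀ {k} → P k →
                ∃ λ m → P m × (∀ j → P j → m ≤ j)
least-witness P? {k} pk with P? 0
... | yes p₀ = 0 , p₀ , λ _ _ → z≤n
least-witness P? {zero}  pk | no ¬p₀ = ⊥-elim (¬p₀ pk)
least-witness P? {suc k} pk | no ¬p₀ with least-witness (P? ∘ suc) pk
... | m , pm , minimal = suc m , pm , λ
  { zero    p₀ → ⊥-elim (¬p₀ p₀)
  ; (suc j) pj → s≤s (minimal j pj) }

2*n≡n+n : ∀ n → 2 * n ≡ n + n
2*n≡n+n n = cong (n +_) (+-identityʳ n)

double≤ : ∀ {r m n} → r ≤ m → r ≤ n → 2 * r ≤ m + n
double≤ {r} r≤m r≤n = ≤-trans (≤-reflexive (2*n≡n+n r)) (+-mono-≤ r≤m r≤n)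

balanced-split : ∀ {D} → 2 ≤ D → ∃₂ λ i j → i ≤ j × j ≤ suc i × D ≡ suc i + suc j
balanced-split {2} _ = 0 , 0 , z≤n , z≤n , refl
balanced-split {3} _ = 0 , 1 , z≤n , s≤s z≤n , refl
balanced-split {1} (s≤s ())
balanced-split {suc (suc (suc (suc D)))} _ with balanced-split {suc (suc D)} (s≤s (s≤s z≤n))
... | i , j , i≤j , j≤1+i , eq =
  suc i , suc j , s≤s i≤j , s≤s j≤1+i , cong (2 +_) (trans eq (sym (+-suc i (suc j))))

sandwich : ∀ {D s} → D ≤ s → s ≤ suc D → (D + 1 ≡ s) ⊎ (D ≡ s)
sandwich {D} D≤s s≤1+D with m≤n⇒m<n∨m≡n s≤1+D
... | inj₁ s<1+D = inj₂ (≤-antisym D≤s (m<1+n⇒m≤n s<1+D))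
... | inj₂ refl  = inj₁ (+-comm D 1)

module _ {a : Level} {A : Set a} where

  Unique⇒lookup-injective : {xs : List A} → Unique xs →
                            ∀ {i j} → lookup xs i ≡ lookup xs j → i ≡ j
  Unique⇒lookup-injective (_ ∷ _)    {zero}  {zero}  _  = refl
  Unique⇒lookup-injective (x≢ ∷ _)   {zero}  {suc j} eq = ⊥-elim (All.lookup x≢ (∈-lookup j) eq)
  Unique⇒lookup-injective (x≢ ∷ _)   {suc i} {zero}  eq = ⊥-elim (All.lookup x≢ (∈-lookup i) (sym eq))
  Unique⇒lookup-injective (_ ∷ uniq) {suc i} {suc j} eq = cong suc (Unique⇒lookup-injective uniq eq)

  lookup-linked : ∀ {ℓ} {R : Rel A ℓ} {xs : List A} → Linked R xs →
                  ∀ i j → suc (toℕ i) ≡ toℕ j → R (lookup xs i) (lookup xs j)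
  lookup-linked (r ∷ _)  zero    (suc zero)    _  = r
  lookup-linked (_ ∷ rs) (suc i) (suc j)       eq = lookup-linked rs i j (suc-injective eq)
  lookup-linked [-]      zero    zero          ()
  lookup-linked (_ ∷ _)  zero    zero          ()
  lookup-linked (_ ∷ _)  zero    (suc (suc _)) ()
  lookup-linked (_ ∷ _)  (suc _) zero          ()

module _ {n : ℕ} (G : Graph n) where

  private
    variable
      a b c p q u v w x y : Fin n
      i j k d : ℕ

  Adj-sym : Adj G u v → Adj G v u
  Adj-sym {u} {v} uv = trans (Graph.sym G v u) uv

  _▷_ : Walk G a b k → Adj G b c → Walk G a c (suc k)
  here      ▷ bc = step bc here
  step ab w ▷ bc = step ab (w ▷ bc)

  reverse : Walk G a b k → Walk G b a k
  reverse here       = here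
  reverse (step e w) = reverse w ▷ Adj-sym e

  _++_ : Walk G a b i → Walk G b c j → Walk G a c (i + j)
  here     ++ w′ = w′
  step e w ++ w′ = step e (w ++ w′)

  splitAt : ∀ i → Walk G a b (i + j) → ∃ λ c → Walk G a c i × Walk G c b j
  splitAt zero    w = _ , here , w
  splitAt (suc i) (step e w) with splitAt i w
  ... | c , ac , cb = c , step e ac , cb

  walk? : ∀ u v k → Dec (Walk G u v k)
  walk? u v zero with u ≟ v
  ... | yes refl = yes here
  ... | no u≢v   = no λ { here → u≢v refl }
  walk? u v (suc k) =
    map′ (λ (_ , e , w) → step e w) (λ { (step e w) → _ , e , w })
         (any? λ w → (Graph.adj G u w Bool.≟ true) ×-dec walk? w v k)

  WalksAtLeast : Fin n → Fin n → ℕ → Set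
  WalksAtLeast u v ℓ = ∀ k → Walk G u v k → ℓ ≤ k

  WalksAtLeast-sym : WalksAtLeast u v k → WalksAtLeast v u k
  WalksAtLeast-sym uv k w = uv k (reverse w)

  Dist-unique : Dist G u v d → Dist G u v k → d ≡ k
  Dist-unique (w , minimal) (w′ , minimal′) = ≤-antisym (minimal _ w′) (minimal′ _ w)

  dist : Connected G → ∀ u v → ∃ (Dist G u v)
  dist con u v = least-witness (walk? u v) (proj₂ (con u v))

  eccentricity : Connected G → ∀ u → ∃ (Ecc G u)
  eccentricity con u = δ far , bounded , far , proj₂ (dist con u far)
    where
    δ : Fin n → ℕ
    δ v = proj₁ (dist con u v)
    far : Fin n
    far = argmax δ u (allFin n)
    bounded : ∀ v k → Dist G u v k → k ≤ δ far
    bounded v k uv = subst (_≤ δ far) (Dist-unique (proj₂ (dist con u v)) uv)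
                       (All.lookup (f[xs]≤f[argmax] u (allFin n)) (∈-allFin v))

  Dist≤diameter : Connected G → ∀ {D} → Diameter G D → Dist G u v d → d ≤ D
  Dist≤diameter {u = u} con (_ , maximal) uv with eccentricity con u
  ... | e , u-ecc@(bounded , _) = ≤-trans (bounded _ _ uv) (maximal u e u-ecc)

  diameter≤2*radius : Connected G → ∀ {r D} → Radius G r → Diameter G D → D ≤ 2 * r
  diameter≤2*radius con {r} ((u , bounded , _) , _) ((x , _ , y , xy , minimal) , _)
    with dist con u x | dist con u y
  ... | d₁ , ux | d₂ , uy =
    ≤-trans (minimal _ (reverse (proj₁ ux) ++ proj₁ uy))
            (≤-trans (+-mono-≤ (bounded x d₁ ux) (bounded y d₂ uy)) (≤-reflexive (sym (2*n≡n+n r))))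

  data WalkAvoiding (c : Fin n) : Fin n → Fin n → Set where
    stop : u ≢ c → WalkAvoiding c u u
    move : u ≢ c → Adj G u v → WalkAvoiding c v w → WalkAvoiding c u w

  _++ᵃ_ : WalkAvoiding c a b → WalkAvoiding c b u → WalkAvoiding c a u
  stop _       ++ᵃ w′ = w′
  move a≢c e w ++ᵃ w′ = move a≢c e (w ++ᵃ w′)

  start≢ : WalkAvoiding c a b → a ≢ c
  start≢ (stop a≢c)     = a≢c
  start≢ (move a≢c _ _) = a≢c

  reverseᵃ : WalkAvoiding c a b → WalkAvoiding c b a
  reverseᵃ (stop a≢c)     = stop a≢c
  reverseᵃ (move a≢c e w) = reverseᵃ w ++ᵃ move (start≢ w) (Adj-sym e) (stop a≢c)

  avoids-or-visits : ∀ c → Walk G a b k →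
                     WalkAvoiding c a b ⊎ ∃₂ λ i j → i + j ≡ k × Walk G a c i × Walk G c b j
  avoids-or-visits {a = a} c here with a ≟ c
  ... | yes refl = inj₂ (0 , 0 , refl , here , here)
  ... | no a≢c   = inj₁ (stop a≢c)
  avoids-or-visits {a = a} c (step e w) with a ≟ c
  ... | yes refl = inj₂ (0 , _ , refl , here , step e w)
  ... | no a≢c with avoids-or-visits c w
  ...   | inj₁ w′                    = inj₁ (move a≢c e w′)
  ...   | inj₂ (i , j , eq , ac , cb) = inj₂ (suc i , j , cong suc eq , step e ac , cb)

  avoids-if-far : ∀ {α β} → WalksAtLeast a c α → WalksAtLeast c b β → k < α + β →
                  Walk G a b k → WalkAvoiding c a b
  avoids-if-far {c = c} ac cb k<α+β w with avoids-or-visits c w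
  ... | inj₁ w′                      = w′
  ... | inj₂ (i , j , refl , ai , jb) = ⊥-elim (<⇒≱ k<α+β (+-mono-≤ (ac i ai) (cb j jb)))

  vertices : WalkAvoiding c a b → List (Fin n)
  vertices (stop {u} _)     = u ∷ []
  vertices (move {u} _ _ w) = u ∷ vertices w

  vertices-avoid : (w : WalkAvoiding c a b) → All (c ≢_) (vertices w)
  vertices-avoid (stop a≢c)     = (a≢c ∘ sym) ∷ []
  vertices-avoid (move a≢c _ w) = (a≢c ∘ sym) ∷ vertices-avoid w

  ∷-linked : Adj G u a → (w : WalkAvoiding c a b) → Linked (Adj G) (u ∷ vertices w)
  ∷-linked e (stop _)      = e ∷ [-]
  ∷-linked e (move _ e′ w) = e ∷ ∷-linked e′ w

  lookup-vertices-last : (w : WalkAvoiding c a b) (j : Fin (length (vertices w))) →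
                         suc (toℕ j) ≡ length (vertices w) → lookup (vertices w) j ≡ b
  lookup-vertices-last (stop _)                 zero    _  = refl
  lookup-vertices-last (move _ _ w)             (suc j) eq = lookup-vertices-last w j (suc-injective eq)
  lookup-vertices-last (move _ _ (stop _))      zero    ()
  lookup-vertices-last (move _ _ (move _ _ _))  zero    ()

  3≤length-vertices : (w : WalkAvoiding c a b) → a ≢ b → ¬ Adj G a b → 3 ≤ length (vertices w)
  3≤length-vertices (stop _)                           a≢b _   = ⊥-elim (a≢b refl)
  3≤length-vertices (move _ ab (stop _))               _   ¬ab = ⊥-elim (¬ab ab)
  3≤length-vertices (move _ _ (move _ _ (stop _)))     _   _   = s≤s (s≤s (s≤s z≤n))
  3≤length-vertices (move _ _ (move _ _ (move _ _ _))) _   _   = s≤s (s≤s (s≤s z≤n))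

  suffix : (w : WalkAvoiding c a b) → u ∈ vertices w → Unique (vertices w) →
           Σ (WalkAvoiding c u b) (Unique ∘ vertices)
  suffix w@(stop _)     (here refl) uniq       = w , uniq
  suffix w@(move _ _ _) (here refl) uniq       = w , uniq
  suffix (move _ _ w)   (there u∈)  (_ ∷ uniq) = suffix w u∈ uniq

  shortcut : WalkAvoiding c a b → Σ (WalkAvoiding c a b) (Unique ∘ vertices)
  shortcut (stop a≢c) = stop a≢c , [] ∷ []
  shortcut {a = a} (move a≢c e w) with shortcut w
  ... | w′ , uniq with a ∈? vertices w′
    where open DecMembership (_≟_ {n})
  ...   | yes a∈ = suffix w′ a∈ uniq
  ...   | no a∉  = move a≢c e w′ , ¬Any⇒All¬ _ a∉ ∷ uniq

  path-cycle : (w : WalkAvoiding c p q) → Unique (vertices w) → Adj G c p → Adj G c q →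
               2 ≤ length (vertices w) → HasCycle G (suc (length (vertices w)))
  path-cycle {c = c} w uniq cp cq 2≤length =
    s≤s 2≤length , lookup (c ∷ vertices w) ,
    Unique⇒lookup-injective (vertices-avoid w ∷ uniq) , lookup-linked (∷-linked cp w) , closing
    where
    closing : ∀ i j → toℕ i ≡ 0 → suc (toℕ j) ≡ suc (length (vertices w)) →
              Adj G (lookup (c ∷ vertices w) j) (lookup (c ∷ vertices w) i)
    closing zero zero    _ eq with () ← subst (2 ≤_) (sym (suc-injective eq)) 2≤length
    closing zero (suc j) _ eq =
      subst (λ z → Adj G z c) (sym (lookup-vertices-last w j (suc-injective eq))) (Adj-sym cq)

  -- c and a p–q path in G − c form a cycle of length ≥ 4.
  nonadjacent-neighbours-separated : (∀ k → HasCycle G k → k ≤ 3) →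
    Adj G c p → Adj G c q → p ≢ q → ¬ Adj G p q → ¬ WalkAvoiding c p q
  nonadjacent-neighbours-separated short cp cq p≢q ¬pq w with shortcut w
  ... | path , uniq = <⇒≱ (s≤s long) (short _ (path-cycle path uniq cp cq (≤-trans (n≤1+n 2) long)))
    where
    long : 3 ≤ length (vertices path)
    long = 3≤length-vertices path p≢q ¬pq

  midpoint-within : Connected G → (∀ k → HasCycle G k → k ≤ 3) → i ≤ j →
                (∀ u v d → Dist G u v d → d ≤ suc i + suc j) → Dist G x y (suc i + suc j) →
                ∃ λ c → ∀ v t → Dist G c v t → t ≤ suc j
  midpoint-within {i = i} {j = j} {x = x} {y = y} con short i≤j diam (xy , xy-minimal)
    with splitAt i (subst (Walk G x y) (sym (+-suc i (suc j))) xy)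
  ... | p , xp , step {w = c} pc (step {w = p′} cp′ p′y) = c , near
    where
    D = suc i + suc j
    xc : WalksAtLeast x c (suc i)
    xc k w = +-cancelʳ-≤ (suc j) (suc i) k (xy-minimal _ (w ++ step cp′ p′y))
    cy : WalksAtLeast c y (suc j)
    cy k w = +-cancelˡ-≤ (suc i) (suc j) k (xy-minimal _ ((xp ▷ pc) ++ w))
    p≢p′ : p ≢ p′
    p≢p′ refl = <⇒≱ (+-mono-< (n<1+n i) (n<1+n j)) (xy-minimal _ (xp ++ p′y))
    p≁p′ : ¬ Adj G p p′
    p≁p′ pp′ = <⇒≱ (+-monoʳ-< (suc i) (n<1+n j)) (xy-minimal _ ((xp ▷ pp′) ++ p′y))
    xp-avoids : WalkAvoiding c x p
    xp-avoids = avoids-if-far xc (λ _ _ → z≤n) (m≤m+n (suc i) 0) xp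
    p′y-avoids : WalkAvoiding c p′ y
    p′y-avoids = avoids-if-far (λ _ _ → z≤n) cy (n<1+n j) p′y
    near : ∀ v t → Dist G c v t → t ≤ suc j
    near v t (_ , cv-minimal) with t ≤? suc j
    ... | yes t≤1+j = t≤1+j
    ... | no t≰1+j  = ⊥-elim (nonadjacent-neighbours-separated short (Adj-sym pc) cp′ p≢p′ p≁p′
                        (reverseᵃ xp-avoids ++ᵃ (xv-avoids ++ᵃ (reverseᵃ yv-avoids ++ᵃ reverseᵃ p′y-avoids))))
      where
      cv : WalksAtLeast c v (suc (suc j))
      cv k w = ≤-trans (≰⇒> t≰1+j) (cv-minimal k w)
      via-xc : D < suc i + suc (suc j)
      via-xc = +-monoʳ-< (suc i) (n<1+n (suc j))
      via-yc : D < suc j + suc (suc j)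
      via-yc = +-mono-≤-< (s≤s i≤j) (n<1+n (suc j))
      xv-avoids : WalkAvoiding c x v
      xv-avoids with dist con x v
      ... | d , xv , xv-minimal = avoids-if-far xc cv (≤-<-trans (diam x v d (xv , xv-minimal)) via-xc) xv
      yv-avoids : WalkAvoiding c y v
      yv-avoids with dist con y v
      ... | d , yv , yv-minimal =
        avoids-if-far (WalksAtLeast-sym cy) cv (≤-<-trans (diam y v d (yv , yv-minimal)) via-yc) yv

  2*radius≤1+diameter : Connected G → Circumference G 3 → ∀ {r D} → Radius G r → Diameter G D →
                        2 * r ≤ suc D
  2*radius≤1+diameter con (_ , short) {r} {D} ((u , u-ecc) , minimal) diam@((x , _ , y , xy) , maximal)
    with 2 ≤? D
  ... | no D≱2 = small D (maximal u r u-ecc) D≱2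
    where
    small : ∀ m → r ≤ m → ¬ 2 ≤ m → 2 * r ≤ suc m
    small 0 r≤0 _ = double≤ r≤0 (m≤n⇒m≤1+n r≤0)
    small 1 r≤1 _ = double≤ r≤1 r≤1
    small (suc (suc _)) _ m≱2 = ⊥-elim (m≱2 (s≤s (s≤s z≤n)))
  ... | yes D≥2 with balanced-split D≥2
  ... | i , j , i≤j , j≤1+i , refl with midpoint-within con short i≤j (λ _ _ _ → Dist≤diameter con diam) xy
  ... | c , near with eccentricity con c
  ... | e , c-ecc@(_ , v , cv) = double≤ (≤-trans r≤1+j (s≤s j≤1+i)) r≤1+j
    where
    r≤1+j : r ≤ suc j
    r≤1+j = ≤-trans (minimal c e c-ecc) (near v e cv)

corollary3 : (n : ℕ) (G : Graph n) → Connected G → Circumference G 3 →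
             (r D : ℕ) → Radius G r → Diameter G D →
             (D + 1 ≡ 2 * r) ⊎ (D ≡ 2 * r)
corollary3 n G con circ r D radius diameter =
  sandwich (diameter≤2*radius G con radius diameter) (2*radius≤1+diameter G con circ radius diameter)
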